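{- The language $\mathcal{L}_{\mathrm{PN}}$ of prefix normal words is a bubble language. That is, if $w\in\mathcal{L}_{\mathrm{PN}}$ contains the factor $01$, and $w'$ is obtained from $w$ by replacing the first occurrence of $01$ by $10$, then $w'\in\mathcal{L}_{\mathrm{PN}}$.
   Context: For a binary word $w$ and $0\le i\le|w|$, let $P(w,i)$ be the number of $1$s in the prefix of $w$ of length $i$. Let $F(w,i)$ be the maximum number of $1$s over all substrings (contiguous factors) of $w$ of length $i$. A binary word $w$ is prefix normal if $F(w,i)=P(w,i)$ for all $1\le i\le|w|$, i.e. no substring has more $1$s than the prefix of the same length. $\mathcal{L}_{\mathrm{PN}}$ denotes the set of all prefix normal words. -}

module Defs where

open import Data.Bool using (Bool; true; false)
open import Data.Nat using (ℕ; zero; suc; _+_; _⊔_)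
open import Data.List using (List; []; _∷_; length; take; drop)
open import Data.Maybe using (Maybe; just; nothing; map)
open import Relation.Binary.PropositionalEquality using (_≡_)

-- Binary words: true = 1, false = 0.
Word : Set
Word = List Bool

ones : Word → ℕ
ones [] = 0
ones (true ∷ w) = suc (ones w)
ones (false ∷ w) = ones w

P : Word → ℕ → ℕ
P w i = ones (take i w)

-- F(w,i): maximum number of 1s over all factors of w of length i.
F : Word → ℕ → ℕ
F [] i = 0
F (a ∷ w) i with length (a ∷ w) Data.Nat.<ᵇ i
... | true  = 0
... | false = ones (take i (a ∷ w)) ⊔ F w i

PrefixNormal : Word → Set
PrefixNormal w = ∀ i → 1 Data.Nat.≤ i → i Data.Nat.≤ length w → F w i ≡ P w i

replaceFirst01 : Word → Maybe Word
replaceFirst01 [] = nothing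
replaceFirst01 (false ∷ true ∷ w) = just (true ∷ false ∷ w)
replaceFirst01 (a ∷ w) = map (a ∷_) (replaceFirst01 w)

-- A word w is prefix normal iff its prefix-count function P w is subadditive,
-- P w (j + i) ≤ P w j + P w i, because the factor of length i at position j
-- has P w (j + i) − P w j ones. Write w = u01v, where u = 1^a 0^b since the
-- 01 is the first one, and w' = u10v. Then P w' agrees with P w except at
-- n + 1 (n = |u|), where it is one larger, so subadditivity of P w' can only
-- fail for j + i = n + 1 with j, i ≥ 1. There P w' j = min(j, a) and
-- P w' i = min(i, a), and min(j, a) + min(i, a) ≥ a + 1 = P w' (n + 1)
-- as soon as a ≥ 1. Finally a ≥ 1, since a prefix normal word containing a
-- 1 starts with a 1.
module Submission where

open import Defs
open import Data.Bool using (true; false; T)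
open import Data.Empty using (⊥-elim)
open import Data.List using ([]; _∷_; length; take; drop; _++_; replicate)
open import Data.List.Properties using (take-[]; take-all; take-take; length-drop)
open import Data.Maybe using (just)
open import Data.Nat using (ℕ; zero; suc; _+_; _⊓_; _⊔_; _≤_; _<_; _<ᵇ_; z≤n; s≤s)
open import Data.Nat.Properties
open import Data.Product using (Σ-syntax; _×_; _,_)
open import Data.Sum using (inj₁; inj₂)
open import Data.Unit using (tt)
open import Function using (_∘_)
open import Relation.Binary.PropositionalEquality
open import Relation.Nullary using (yes; no)

ones≤length : ∀ w → ones w ≤ length w
ones≤length [] = z≤n
ones≤length (true ∷ w) = s≤s (ones≤length w)
ones≤length (false ∷ w) = m≤n⇒m≤1+n (ones≤length w)

length-drop≤ : ∀ j (w : Word) → length (drop j w) ≤ length w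
length-drop≤ j w = ≤-trans (≤-reflexive (length-drop j w)) (m∸n≤m (length w) j)

P-mono : ∀ w {m n} → m ≤ n → P w m ≤ P w n
P-mono w z≤n = z≤n
P-mono [] (s≤s m≤n) = z≤n
P-mono (true ∷ w) (s≤s m≤n) = s≤s (P-mono w m≤n)
P-mono (false ∷ w) (s≤s m≤n) = P-mono w m≤n

P-+ : ∀ w j i → P w (j + i) ≡ P w j + ones (take i (drop j w))
P-+ w zero i = refl
P-+ [] (suc j) i = cong ones (sym (take-[] i))
P-+ (true ∷ w) (suc j) i = cong suc (P-+ w j i)
P-+ (false ∷ w) (suc j) i = P-+ w j i

P-++ˡ : ∀ u x {k} → k ≤ length u → P (u ++ x) k ≡ P u k
P-++ˡ [] x z≤n = refl
P-++ˡ (a ∷ u) x z≤n = refl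
P-++ˡ (true ∷ u) x (s≤s k≤n) = cong suc (P-++ˡ u x k≤n)
P-++ˡ (false ∷ u) x (s≤s k≤n) = P-++ˡ u x k≤n

P-++-length : ∀ u x k → P (u ++ x) (length u + k) ≡ ones u + P x k
P-++-length [] x k = refl
P-++-length (true ∷ u) x k = cong suc (P-++-length u x k)
P-++-length (false ∷ u) x k = P-++-length u x k

F-∷ : ∀ a w {i} → i ≤ length (a ∷ w) → F (a ∷ w) i ≡ ones (take i (a ∷ w)) ⊔ F w i
F-∷ a w {i} i≤ with length (a ∷ w) <ᵇ i in eq
... | true = ⊥-elim (<⇒≱ (<ᵇ⇒< (length (a ∷ w)) i (subst T (sym eq) tt)) i≤)
... | false = refl

factor≤F : ∀ w j i → i ≤ length (drop j w) → ones (take i (drop j w)) ≤ F w i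
factor≤F [] zero .0 z≤n = z≤n
factor≤F [] (suc j) .0 z≤n = z≤n
factor≤F (a ∷ w) zero i i≤ = ≤-trans (m≤m⊔n _ _) (≤-reflexive (sym (F-∷ a w i≤)))
factor≤F (a ∷ w) (suc j) i i≤ =
  ≤-trans (factor≤F w j i i≤)
    (≤-trans (m≤n⊔m _ _) (≤-reflexive (sym (F-∷ a w (m≤n⇒m≤1+n (≤-trans i≤ (length-drop≤ j w)))))))

F-lub : ∀ w i {b} → (∀ j → ones (take i (drop j w)) ≤ b) → F w i ≤ b
F-lub [] i f = z≤n
F-lub (a ∷ w) i f with length (a ∷ w) <ᵇ i
... | true = z≤n
... | false = ⊔-lub (f 0) (F-lub w i (f ∘ suc))

-- PrefixNormal only constrains lengths up to |w|, so a factor running past the end is first truncated.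
prefixNormal⇒factor≤prefix : ∀ {w} → PrefixNormal w → ∀ j i → ones (take i (drop j w)) ≤ P w i
prefixNormal⇒factor≤prefix {w} pn j i = begin
  ones (take i d)                ≡⟨ cong (ones ∘ take i) (sym (take-all (length d) d ≤-refl)) ⟩
  ones (take i (take (length d) d)) ≡⟨ cong ones (take-take i (length d) d) ⟩
  ones (take (i ⊓ length d) d)   ≤⟨ fitting (i ⊓ length d) (m⊓n≤n i (length d)) ⟩
  P w (i ⊓ length d)             ≤⟨ P-mono w (m⊓n≤m i (length d)) ⟩
  P w i                          ∎
  where
  open ≤-Reasoning
  d = drop j w
  fitting : ∀ k → k ≤ length d → ones (take k d) ≤ P w k
  fitting zero _ = z≤n
  fitting (suc k) k≤ =
    ≤-trans (factor≤F w j (suc k) k≤) (≤-reflexive (pn (suc k) (s≤s z≤n) (≤-trans k≤ (length-drop≤ j w))))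

Subadditive : Word → Set
Subadditive w = ∀ j i → P w (j + i) ≤ P w j + P w i

prefixNormal⇒subadditive : ∀ {w} → PrefixNormal w → Subadditive w
prefixNormal⇒subadditive {w} pn j i = begin
  P w (j + i)                         ≡⟨ P-+ w j i ⟩
  P w j + ones (take i (drop j w))    ≤⟨ +-monoʳ-≤ (P w j) (prefixNormal⇒factor≤prefix pn j i) ⟩
  P w j + P w i                       ∎
  where open ≤-Reasoning

subadditive⇒prefixNormal : ∀ {w} → Subadditive w → PrefixNormal w
subadditive⇒prefixNormal {w} sub i _ i≤ = ≤-antisym (F-lub w i factor≤prefix) (factor≤F w 0 i i≤)
  where
  factor≤prefix : ∀ j → ones (take i (drop j w)) ≤ P w i
  factor≤prefix j = +-cancelˡ-≤ (P w j) _ _ (subst (_≤ P w j + P w i) (P-+ w j i) (sub j i))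

P-swap-≤ : ∀ u v k → P (u ++ false ∷ true ∷ v) k ≤ P (u ++ true ∷ false ∷ v) k
P-swap-≤ [] v zero = z≤n
P-swap-≤ [] v (suc zero) = z≤n
P-swap-≤ [] v (suc (suc k)) = ≤-refl
P-swap-≤ (a ∷ u) v zero = z≤n
P-swap-≤ (true ∷ u) v (suc k) = s≤s (P-swap-≤ u v k)
P-swap-≤ (false ∷ u) v (suc k) = P-swap-≤ u v k

P-swap-≡ : ∀ u v k → k ≢ suc (length u) → P (u ++ true ∷ false ∷ v) k ≡ P (u ++ false ∷ true ∷ v) k
P-swap-≡ [] v zero _ = refl
P-swap-≡ [] v (suc zero) k≢ = ⊥-elim (k≢ refl)
P-swap-≡ [] v (suc (suc k)) _ = refl
P-swap-≡ (a ∷ u) v zero _ = refl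
P-swap-≡ (true ∷ u) v (suc k) k≢ = cong suc (P-swap-≡ u v k (k≢ ∘ cong suc))
P-swap-≡ (false ∷ u) v (suc k) k≢ = P-swap-≡ u v k (k≢ ∘ cong suc)

data OnesThenZeros : Word → Set where
  zeros : ∀ b → OnesThenZeros (replicate b false)
  one∷_ : ∀ {u} → OnesThenZeros u → OnesThenZeros (true ∷ u)

ones-zeros : ∀ b → ones (replicate b false) ≡ 0
ones-zeros zero = refl
ones-zeros (suc b) = ones-zeros b

P-zeros : ∀ b k → P (replicate b false) k ≡ 0
P-zeros zero k = cong ones (take-[] k)
P-zeros (suc b) zero = refl
P-zeros (suc b) (suc k) = P-zeros b k

P-onesThenZeros : ∀ {u} → OnesThenZeros u → ∀ k → P u k ≡ k ⊓ ones u
P-onesThenZeros (zeros b) k =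
  trans (P-zeros b k) (trans (sym (⊓-zeroʳ k)) (cong (k ⊓_) (sym (ones-zeros b))))
P-onesThenZeros (one∷ s) zero = refl
P-onesThenZeros (one∷ s) (suc k) = cong suc (P-onesThenZeros s k)

⊓-sum-crossing : ∀ {a j i} → 1 ≤ a → 1 ≤ j → 1 ≤ i → a < j + i → a < j ⊓ a + i ⊓ a
⊓-sum-crossing {a} {j} {i} 1≤a 1≤j 1≤i a<j+i with ≤-total j a | ≤-total i a
... | inj₂ a≤j | _ rewrite m≥n⇒m⊓n≡n a≤j = m<m+n a (⊓-glb 1≤i 1≤a)
... | inj₁ j≤a | inj₂ a≤i rewrite m≤n⇒m⊓n≡m j≤a | m≥n⇒m⊓n≡n a≤i = m<n+m a 1≤j
... | inj₁ j≤a | inj₁ i≤a rewrite m≤n⇒m⊓n≡m j≤a | m≤n⇒m⊓n≡m i≤a = a<j+i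

module Swap {u : Word} (v : Word) (s : OnesThenZeros u) where

  w w' : Word
  w = u ++ false ∷ true ∷ v
  w' = u ++ true ∷ false ∷ v

  n a : ℕ
  n = length u
  a = ones u

  P-inside : ∀ x {k} → k ≤ n → P (u ++ x) k ≡ k ⊓ a
  P-inside x k≤n = trans (P-++ˡ u x k≤n) (P-onesThenZeros s _)

  P-beyond : ∀ x k → P (u ++ x) (k + n) ≡ P x k + a
  P-beyond x k = trans (cong (P (u ++ x)) (+-comm k n)) (trans (P-++-length u x k) (+-comm a (P x k)))

  -- Subadditivity at (1, n + 1): the 1 after u0 forces the first letter of w to be 1.
  starts-with-one : Subadditive w → 1 ≤ n → 1 ≤ a
  starts-with-one sub 1≤n = ≤-trans first-is-one (m⊓n≤n 1 a)
    where
    first-is-one : 1 ≤ 1 ⊓ a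
    first-is-one = subst (1 ≤_) (P-inside (false ∷ true ∷ v) 1≤n)
      (+-cancelʳ-≤ a 1 (P w 1)
        (subst₂ (λ l r → l ≤ P w 1 + r) (P-beyond _ 2) (P-beyond _ 1) (sub 1 (suc n))))

  crossing : Subadditive w → ∀ j i → j + i ≡ suc n → P w' (suc n) ≤ P w' j + P w' i
  crossing sub zero i refl = ≤-refl
  crossing sub j zero j+0≡ = subst (λ k → P w' k ≤ P w' j + 0) (trans (sym (+-identityʳ j)) j+0≡) (m≤m+n (P w' j) 0)
  crossing sub (suc j) (suc i) j+i≡ = begin
    P w' (suc n)               ≡⟨ P-beyond _ 1 ⟩
    suc a                      ≤⟨ ⊓-sum-crossing 1≤a (s≤s z≤n) (s≤s z≤n) a<j+i ⟩
    suc j ⊓ a + suc i ⊓ a      ≡⟨ sym (cong₂ _+_ (P-inside _ j<n) (P-inside _ i<n)) ⟩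
    P w' (suc j) + P w' (suc i) ∎
    where
    open ≤-Reasoning
    i<n : suc i ≤ n
    i<n = m+n≤o⇒n≤o j (≤-reflexive (suc-injective j+i≡))
    j<n : suc j ≤ n
    j<n = m+n≤o⇒n≤o i (≤-reflexive (suc-injective (trans (+-comm (suc i) (suc j)) j+i≡)))
    1≤a : 1 ≤ a
    1≤a = starts-with-one sub (≤-trans (s≤s z≤n) i<n)
    a<j+i : a < suc j + suc i
    a<j+i = subst (a <_) (sym j+i≡) (s≤s (ones≤length u))

  subadditive : Subadditive w → Subadditive w'
  subadditive sub j i with j + i ≟ suc n
  ... | yes j+i≡ = subst (λ k → P w' k ≤ P w' j + P w' i) (sym j+i≡) (crossing sub j i j+i≡)
  ... | no j+i≢ = begin
    P w' (j + i)    ≡⟨ P-swap-≡ u v (j + i) j+i≢ ⟩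
    P w (j + i)     ≤⟨ sub j i ⟩
    P w j + P w i   ≤⟨ +-mono-≤ (P-swap-≤ u v j) (P-swap-≤ u v i) ⟩
    P w' j + P w' i ∎
    where open ≤-Reasoning

replaceFirst01-split : ∀ w {w'} → replaceFirst01 w ≡ just w' →
  Σ[ u ∈ Word ] Σ[ v ∈ Word ] OnesThenZeros u × w ≡ u ++ false ∷ true ∷ v × w' ≡ u ++ true ∷ false ∷ v
replaceFirst01-split [] ()
replaceFirst01-split (false ∷ true ∷ w) refl = [] , w , zeros 0 , refl , refl
replaceFirst01-split (false ∷ []) ()
replaceFirst01-split (false ∷ false ∷ w) eq with replaceFirst01 (false ∷ w) in e
replaceFirst01-split (false ∷ false ∷ w) refl | just x with replaceFirst01-split (false ∷ w) e
... | u , v , s , w≡ , refl = false ∷ u , v , prepend-zero s w≡ , cong (false ∷_) w≡ , refl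
  where
  prepend-zero : ∀ {u r} → OnesThenZeros u → false ∷ w ≡ u ++ r → OnesThenZeros (false ∷ u)
  prepend-zero (zeros b) _ = zeros (suc b)
replaceFirst01-split (true ∷ w) eq with replaceFirst01 w in e
replaceFirst01-split (true ∷ w) refl | just x with replaceFirst01-split w e
... | u , v , s , refl , refl = true ∷ u , v , one∷ s , refl , refl

lemma1 : (w w' : Word) → PrefixNormal w → replaceFirst01 w ≡ just w' → PrefixNormal w'
lemma1 w w' pn eq with replaceFirst01-split w eq
... | u , v , s , refl , refl =
  subadditive⇒prefixNormal (Swap.subadditive v s (prefixNormal⇒subadditive pn))
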